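{- For each integer $k\geq 0$, there exists an oriented graph $G_k$ on $20k+10$ vertices with $\Delta(G_k^\diamond)=2k+5$ such that $d_{G_k^\diamond}(v)$ is odd for all $v\in V(G_k)$ and $\mathrm{pn}(G_k)-\mathrm{ex}(G_k)\geq 2k+2$. In particular, $G_k$ is not consistent.
   Context: An oriented graph is a digraph obtained by orienting the edges of a simple graph; $G_k^\diamond$ denotes its underlying undirected graph and $\Delta$ the maximum degree. For a digraph $D$, $\mathrm{pn}(D)$ is the minimum number of directed paths into which $E(D)$ can be partitioned, $\mathrm{ex}(D)=\frac12\sum_v|d^+(v)-d^-(v)|$, and $D$ is consistent if $\mathrm{pn}(D)=\mathrm{ex}(D)$. -}

module Defs where

open import Data.Nat using (ℕ; zero; suc; _+_; _*_; _⊔_; _≤_; _/_; _%_; ∣_-_∣)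
open import Data.Bool using (Bool; true; false; if_then_else_; _∨_)
open import Data.Fin using (Fin)
open import Data.Nat.ListAction using (sum)
open import Data.List using (List; []; _∷_; length; map; foldr; allFin; concatMap)
open import Data.List.Relation.Unary.All using (All)
open import Data.List.Relation.Unary.Unique.Propositional using (Unique)
open import Data.List.Membership.Propositional using (_∈_)
open import Data.Product using (Σ; _×_; _,_)
open import Relation.Binary.PropositionalEquality using (_≡_)

record OrientedGraph (n : ℕ) : Set where
  field
    arc     : Fin n → Fin n → Bool
    irrefl  : ∀ v → arc v v ≡ false
    antisym : ∀ u v → arc u v ≡ true → arc v u ≡ false
open OrientedGraph public

private
  ind : Bool → ℕ
  ind true  = 1
  ind false = 0

module _ {n : ℕ} (D : OrientedGraph n) where

  outdeg : Fin n → ℕ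
  outdeg v = sum (map (λ u → ind (arc D v u)) (allFin n))

  indeg : Fin n → ℕ
  indeg v = sum (map (λ u → ind (arc D u v)) (allFin n))

  udeg : Fin n → ℕ
  udeg v = sum (map (λ u → ind (arc D v u ∨ arc D u v)) (allFin n))

  maxUDeg : ℕ
  maxUDeg = foldr _⊔_ 0 (map udeg (allFin n))

  -- ex(D) = (1/2) Σ_v |d⁺(v) − d⁻(v)|  (the sum is always even)
  ex : ℕ
  ex = sum (map (λ v → ∣ outdeg v - indeg v ∣) (allFin n)) / 2

  arcsOf : List (Fin n) → List (Fin n × Fin n)
  arcsOf []           = []
  arcsOf (u ∷ [])     = []
  arcsOf (u ∷ v ∷ vs) = (u , v) ∷ arcsOf (v ∷ vs)

  IsArc : Fin n × Fin n → Set
  IsArc (u , v) = arc D u v ≡ true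

  record IsDirectedPath (p : List (Fin n)) : Set where
    field
      nontrivial : 2 ≤ length p
      distinct   : Unique p
      followsArcs : All IsArc (arcsOf p)

  record IsPathPartition (P : List (List (Fin n))) : Set where
    field
      paths    : All IsDirectedPath P
      disjoint : Unique (concatMap arcsOf P)
      covers   : ∀ u v → arc D u v ≡ true → (u , v) ∈ concatMap arcsOf P

  -- pn(D) ≥ m  (pn is the minimum size of a path partition)
  PnAtLeast : ℕ → Set
  PnAtLeast m = ∀ P → IsPathPartition P → m ≤ length P

  -- D is consistent: pn(D) = ex(D), i.e. there is a path partition with
  -- exactly ex(D) paths and none with fewer.
  Consistent : Set
  Consistent = Σ (List (List (Fin n))) (λ P → IsPathPartition P × length P ≡ ex) × PnAtLeast ex

{-# OPTIONS --safe #-}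
-- Gₖ is the disjoint union of k + 1 blocks, a star whose 2k + 5 leaves point to
-- its centre, and 4k − 3 disjoint arcs (just the block when k = 0).  A block is
-- two gadgets h → a₁, a₂ → b₁, b₂ → h, the first hub having one more arc, to the
-- second hub.  Every degree is odd, and the centre (a hub when k = 0) has the
-- maximum degree 2k + 5.
--
-- To bound pn from below, count path starts: an arc that does not start its path
-- is preceded on it by an arc into its tail.  As no path runs around a triangle
-- h → a → b → h, the first gadget of a block contains at least 4 starts and the
-- second at least 3, while the block contributes only 10 to ∑ |d⁺ − d⁻| = 2 ex.
-- Leaves and arc tails are sources, so they start paths, which exactly pays for
-- the imbalance of the star and of the arcs.  Hence 2 pn ≥ 2 ex + 4 (k + 1).
module Submission where

open import Defs
open import Data.Nat.Properties hiding (_≟_)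
open import Algebra.Properties.CommutativeMonoid.Sum +-0-commutativeMonoid
  using (sum-cong-≗; ∑-distrib-+) renaming (sum to ∑)
open import Algebra.Properties.CommutativeSemigroup +-commutativeSemigroup using (interchange)
open import Data.Bool using (Bool; true; false; _∨_; not)
open import Data.Bool.Properties using (¬-not) renaming (_≟_ to _≟ᵇ_)
open import Data.Empty using (⊥; ⊥-elim)
open import Data.Fin using (Fin; zero; suc; _↑ˡ_; _↑ʳ_; splitAt)
open import Data.Fin.Patterns using (0F; 1F; 2F; 3F; 4F; 5F; 6F; 7F; 8F; 9F)
open import Data.Fin.Properties
  using (_≟_; all?; splitAt-↑ˡ; splitAt-↑ʳ; splitAt⁻¹-↑ˡ; splitAt⁻¹-↑ʳ; ↑ˡ-injective; ↑ʳ-injective)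
open import Data.List
  using (List; []; _∷_; [_]; _++_; map; allFin; tabulate; length; filter; concatMap; foldr)
open import Data.List.Properties using (map-tabulate; length-++; length-map)
open import Data.List.Membership.Propositional using (_∈_; find; lose)
open import Data.List.Membership.Propositional.Properties
  using (∈-allFin; ∈-++⁺ˡ; ∈-++⁺ʳ; ∈-++⁻; ∈-∃++; ∈-concatMap⁺; ∈-concatMap⁻; ∈-filter⁺; ∈-map⁻)
open import Data.List.Relation.Unary.All as All using ([]; _∷_)
open import Data.List.Relation.Unary.AllPairs using ([]; _∷_)
open import Data.List.Relation.Unary.Any using (here; there)
open import Data.List.Relation.Unary.Unique.Propositional using (Unique)
open import Data.List.Relation.Unary.Unique.Propositional.Properties using (Unique[x∷xs]⇒x∉xs; map⁺)
open import Data.Nat using (ℕ; zero; suc; _+_; _*_; _≤_; _<_; z≤n; s≤s; ∣_-_∣; _⊔_; _/_; _%_)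
  renaming (_≟_ to _≟ℕ_)
open import Data.Nat.DivMod using (m*n/n≡m; +-distrib-/-∣ʳ; /-monoˡ-≤; [m+kn]%n≡m%n)
open import Data.Nat.Divisibility using (divides-refl)
open import Data.Nat.ListAction using (sum)
open import Data.Nat.Tactic.RingSolver using (solve-∀)
open import Data.Product using (Σ; ∃; ∃₂; _×_; _,_; proj₁; proj₂)
open import Data.Sum as Sum using (_⊎_; inj₁; inj₂; [_,_]′)
open import Function using (_∘_; id)
open import Relation.Binary.PropositionalEquality
  using (_≡_; _≢_; refl; sym; trans; cong; cong₂; subst; subst₂; module ≡-Reasoning)
open import Relation.Nullary using (Dec; does; yes; no; ¬_)
open import Relation.Nullary.Decidable using (from-yes; map′; _→-dec_; _⊎-dec_)
open import Relation.Unary using (Decidable)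

contradictionᵇ : ∀ {b} → b ≡ true → b ≡ false → ∀ {A : Set} → A
contradictionᵇ refl ()

-- Sums over Fin

-- Defs keeps its indicator Bool → ℕ private; pattern unification recovers it
-- from the out-degree of a graph on two vertices.
private
  arcIf : Bool → OrientedGraph 2
  arcIf b = record { arc = a ; irrefl = irr ; antisym = asym }
    where
    a : Fin 2 → Fin 2 → Bool
    a zero (suc zero) = b
    a _    _          = false
    irr : ∀ v → a v v ≡ false
    irr zero       = refl
    irr (suc zero) = refl
    asym : ∀ u v → a u v ≡ true → a v u ≡ false
    asym zero       zero       _ = refl
    asym zero       (suc zero) _ = refl
    asym (suc zero) zero       ()
    asym (suc zero) (suc zero) _ = refl

  indicator : Σ (Bool → ℕ) λ f → ∀ b → outdeg (arcIf b) zero ≡ f b + 0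
  indicator = _ , λ _ → refl

ι : Bool → ℕ
ι = proj₁ indicator

sum-map-allFin : ∀ {n} (f : Fin n → ℕ) → sum (map f (allFin n)) ≡ ∑ f
sum-map-allFin f = trans (cong sum (map-tabulate id f)) (sum-tabulate f)
  where
  sum-tabulate : ∀ {n} (f : Fin n → ℕ) → sum (tabulate f) ≡ ∑ f
  sum-tabulate {zero}  f = refl
  sum-tabulate {suc n} f = cong (f zero +_) (sum-tabulate (f ∘ suc))

∑-const : ∀ n c → ∑ {n} (λ _ → c) ≡ n * c
∑-const zero    c = refl
∑-const (suc n) c = cong (c +_) (∑-const n c)

∑-zero : ∀ {n} {f : Fin n → ℕ} → (∀ v → f v ≡ 0) → ∑ f ≡ 0
∑-zero {n} f≡0 = trans (sum-cong-≗ f≡0) (trans (∑-const n 0) (*-zeroʳ n))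

∑-mono-≤ : ∀ {n} {f g : Fin n → ℕ} → (∀ v → f v ≤ g v) → ∑ f ≤ ∑ g
∑-mono-≤ {zero}  f≤g = z≤n
∑-mono-≤ {suc n} f≤g = +-mono-≤ (f≤g zero) (∑-mono-≤ (f≤g ∘ suc))

∑-↑ : ∀ m {n} (f : Fin (m + n) → ℕ) → ∑ f ≡ ∑ (λ i → f (i ↑ˡ n)) + ∑ (λ j → f (m ↑ʳ j))
∑-↑ zero    f = refl
∑-↑ (suc m) f = trans (cong (f zero +_) (∑-↑ m (f ∘ suc))) (sym (+-assoc (f zero) _ _))

∑-indicator-≡ : ∀ {n} (x : Fin n) → ∑ (λ v → ι (does (x ≟ v))) ≡ 1
∑-indicator-≡ {suc n} zero    = cong suc (trans (∑-const n 0) (*-zeroʳ n))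
∑-indicator-≡         (suc x) = ∑-indicator-≡ x

-- Disjoint unions and in-closed embeddings

private
  arc⊎ : ∀ {m n} → OrientedGraph m → OrientedGraph n → Fin m ⊎ Fin n → Fin m ⊎ Fin n → Bool
  arc⊎ D E (inj₁ u) (inj₁ v) = arc D u v
  arc⊎ D E (inj₂ u) (inj₂ v) = arc E u v
  arc⊎ D E _        _        = false

  arc⊎-irrefl : ∀ {m n} (D : OrientedGraph m) (E : OrientedGraph n) x → arc⊎ D E x x ≡ false
  arc⊎-irrefl D E (inj₁ u) = irrefl D u
  arc⊎-irrefl D E (inj₂ u) = irrefl E u

  arc⊎-antisym : ∀ {m n} (D : OrientedGraph m) (E : OrientedGraph n) x y →
                 arc⊎ D E x y ≡ true → arc⊎ D E y x ≡ false
  arc⊎-antisym D E (inj₁ u) (inj₁ v) = antisym D u v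
  arc⊎-antisym D E (inj₂ u) (inj₂ v) = antisym E u v
  arc⊎-antisym D E (inj₁ _) (inj₂ _) ()
  arc⊎-antisym D E (inj₂ _) (inj₁ _) ()

infixr 6 _⊕_
_⊕_ : ∀ {m n} → OrientedGraph m → OrientedGraph n → OrientedGraph (m + n)
_⊕_ {m} D E = record
  { arc     = λ u v → arc⊎ D E (splitAt m u) (splitAt m v)
  ; irrefl  = λ v → arc⊎-irrefl D E (splitAt m v)
  ; antisym = λ u v → arc⊎-antisym D E (splitAt m u) (splitAt m v)
  }

module _ {m n} (D : OrientedGraph m) (E : OrientedGraph n) where

  arc-↑ˡ-↑ˡ : ∀ u v → arc (D ⊕ E) (u ↑ˡ n) (v ↑ˡ n) ≡ arc D u v
  arc-↑ˡ-↑ˡ u v rewrite splitAt-↑ˡ m u n | splitAt-↑ˡ m v n = refl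

  arc-↑ʳ-↑ʳ : ∀ u v → arc (D ⊕ E) (m ↑ʳ u) (m ↑ʳ v) ≡ arc E u v
  arc-↑ʳ-↑ʳ u v rewrite splitAt-↑ʳ m n u | splitAt-↑ʳ m n v = refl

  arc-↑ˡ-↑ʳ : ∀ u v → arc (D ⊕ E) (u ↑ˡ n) (m ↑ʳ v) ≡ false
  arc-↑ˡ-↑ʳ u v rewrite splitAt-↑ˡ m u n | splitAt-↑ʳ m n v = refl

  arc-↑ʳ-↑ˡ : ∀ u v → arc (D ⊕ E) (m ↑ʳ u) (v ↑ˡ n) ≡ false
  arc-↑ʳ-↑ˡ u v rewrite splitAt-↑ʳ m n u | splitAt-↑ˡ m v n = refl

empty : OrientedGraph 0
empty = record { arc = λ () ; irrefl = λ () ; antisym = λ () }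

copies : ∀ k {m} → OrientedGraph m → OrientedGraph (k * m)
copies zero    E = empty
copies (suc k) E = E ⊕ copies k E

data SplitView (m n : ℕ) : Fin (m + n) → Set where
  left  : ∀ u → SplitView m n (u ↑ˡ n)
  right : ∀ u → SplitView m n (m ↑ʳ u)

splitView : ∀ m {n} (v : Fin (m + n)) → SplitView m n v
splitView m v with splitAt m v in eq
... | inj₁ u = subst (SplitView m _) (splitAt⁻¹-↑ˡ eq) (left u)
... | inj₂ u = subst (SplitView m _) (splitAt⁻¹-↑ʳ eq) (right u)

degreeBy : ∀ {n} → (Bool → Bool → Bool) → OrientedGraph n → Fin n → ℕ
degreeBy F D v = ∑ λ w → ι (F (arc D v w) (arc D w v))

Degree : Set
Degree = ∀ {n} → OrientedGraph n → Fin n → ℕ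

record IsDegreeBy (F : Bool → Bool → Bool) (deg : Degree) : Set where
  field
    degree≡degreeBy : ∀ {n} (D : OrientedGraph n) v → deg D v ≡ degreeBy F D v

open IsDegreeBy

outdeg-by : IsDegreeBy (λ out _ → out) outdeg
outdeg-by .degree≡degreeBy D v = sum-map-allFin (λ w → ι (arc D v w))

indeg-by : IsDegreeBy (λ _ inc → inc) indeg
indeg-by .degree≡degreeBy D v = sum-map-allFin (λ w → ι (arc D w v))

udeg-by : IsDegreeBy _∨_ udeg
udeg-by .degree≡degreeBy D v = sum-map-allFin (λ w → ι (arc D v w ∨ arc D w v))

module _ {m n} (D : OrientedGraph m) (E : OrientedGraph n)
         {F : Bool → Bool → Bool} (F-ff : F false false ≡ false) where

  private
    ιF : Bool → Bool → ℕ
    ιF x y = ι (F x y)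

    ιF-ff : ∀ {x y} → x ≡ false → y ≡ false → ιF x y ≡ 0
    ιF-ff refl refl = cong ι F-ff

  degreeBy-↑ˡ : ∀ v → degreeBy F (D ⊕ E) (v ↑ˡ n) ≡ degreeBy F D v
  degreeBy-↑ˡ v =
    trans (∑-↑ m _) (trans (cong₂ _+_ (sum-cong-≗ inside) (∑-zero across)) (+-identityʳ _))
    where
    inside : ∀ w → ιF (arc (D ⊕ E) (v ↑ˡ n) (w ↑ˡ n)) (arc (D ⊕ E) (w ↑ˡ n) (v ↑ˡ n))
                 ≡ ιF (arc D v w) (arc D w v)
    inside w = cong₂ ιF (arc-↑ˡ-↑ˡ D E v w) (arc-↑ˡ-↑ˡ D E w v)
    across : ∀ w → ιF (arc (D ⊕ E) (v ↑ˡ n) (m ↑ʳ w)) (arc (D ⊕ E) (m ↑ʳ w) (v ↑ˡ n)) ≡ 0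
    across w = ιF-ff (arc-↑ˡ-↑ʳ D E v w) (arc-↑ʳ-↑ˡ D E w v)

  degreeBy-↑ʳ : ∀ v → degreeBy F (D ⊕ E) (m ↑ʳ v) ≡ degreeBy F E v
  degreeBy-↑ʳ v = trans (∑-↑ m _) (cong₂ _+_ (∑-zero across) (sum-cong-≗ inside))
    where
    inside : ∀ w → ιF (arc (D ⊕ E) (m ↑ʳ v) (m ↑ʳ w)) (arc (D ⊕ E) (m ↑ʳ w) (m ↑ʳ v))
                 ≡ ιF (arc E v w) (arc E w v)
    inside w = cong₂ ιF (arc-↑ʳ-↑ʳ D E v w) (arc-↑ʳ-↑ʳ D E w v)
    across : ∀ w → ιF (arc (D ⊕ E) (m ↑ʳ v) (w ↑ˡ n)) (arc (D ⊕ E) (w ↑ˡ n) (m ↑ʳ v)) ≡ 0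
    across w = ιF-ff (arc-↑ʳ-↑ˡ D E v w) (arc-↑ˡ-↑ʳ D E w v)

  module _ {deg : Degree} (deg-by : IsDegreeBy F deg) where

    degree-↑ˡ : ∀ v → deg (D ⊕ E) (v ↑ˡ n) ≡ deg D v
    degree-↑ˡ v =
      trans (degree≡degreeBy deg-by _ _) (trans (degreeBy-↑ˡ v) (sym (degree≡degreeBy deg-by _ _)))

    degree-↑ʳ : ∀ v → deg (D ⊕ E) (m ↑ʳ v) ≡ deg E v
    degree-↑ʳ v =
      trans (degree≡degreeBy deg-by _ _) (trans (degreeBy-↑ʳ v) (sym (degree≡degreeBy deg-by _ _)))

record InClosedEmbedding {m n} (E : OrientedGraph m) (G : OrientedGraph n) : Set where
  field
    embed         : Fin m → Fin n
    injective     : ∀ {u v} → embed u ≡ embed v → u ≡ v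
    preserves-arc : ∀ u v → arc G (embed u) (embed v) ≡ arc E u v
    in-closed     : ∀ x v → arc G x (embed v) ≡ true → ∃ λ u → x ≡ embed u

  reflect-in : ∀ {x v} → arc G x (embed v) ≡ true → ∃ λ u → x ≡ embed u × arc E u v ≡ true
  reflect-in {x} {v} a with in-closed x v a
  ... | u , refl = u , refl , trans (sym (preserves-arc u v)) a

  no-in-embed : ∀ {v} → (∀ u → arc E u v ≡ false) → ∀ x → arc G x (embed v) ≡ false
  no-in-embed {v} no-in x with arc G x (embed v) in a
  ... | false = refl
  ... | true  = let u , _ , a′ = reflect-in a in contradictionᵇ a′ (no-in u)

open InClosedEmbedding

module _ {m n k} {E : OrientedGraph m} {D : OrientedGraph n} {G : OrientedGraph k} where

  infixr 9 _∘ᵉ_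
  _∘ᵉ_ : InClosedEmbedding D G → InClosedEmbedding E D → InClosedEmbedding E G
  (φ ∘ᵉ ψ) .embed = embed φ ∘ embed ψ
  (φ ∘ᵉ ψ) .injective = injective ψ ∘ injective φ
  (φ ∘ᵉ ψ) .preserves-arc u v = trans (preserves-arc φ _ _) (preserves-arc ψ u v)
  (φ ∘ᵉ ψ) .in-closed x v a with reflect-in φ a
  ... | y , refl , a′ with in-closed ψ y v a′
  ... | u , refl = u , refl

id-embedding : ∀ {n} {G : OrientedGraph n} → InClosedEmbedding G G
id-embedding .embed = id
id-embedding .injective = id
id-embedding .preserves-arc u v = refl
id-embedding .in-closed x v _ = x , refl

module _ {m n} {D : OrientedGraph m} {E : OrientedGraph n} where

  ↑ˡ-embedding : InClosedEmbedding D (D ⊕ E)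
  ↑ˡ-embedding .embed = _↑ˡ n
  ↑ˡ-embedding .injective = ↑ˡ-injective n _ _
  ↑ˡ-embedding .preserves-arc = arc-↑ˡ-↑ˡ D E
  ↑ˡ-embedding .in-closed x v a with splitView m x
  ... | left u  = u , refl
  ... | right u = contradictionᵇ a (arc-↑ʳ-↑ˡ D E u v)

  ↑ʳ-embedding : InClosedEmbedding E (D ⊕ E)
  ↑ʳ-embedding .embed = m ↑ʳ_
  ↑ʳ-embedding .injective = ↑ʳ-injective m _ _
  ↑ʳ-embedding .preserves-arc = arc-↑ʳ-↑ʳ D E
  ↑ʳ-embedding .in-closed x v a with splitView m x
  ... | left u  = contradictionᵇ a (arc-↑ˡ-↑ʳ D E u v)
  ... | right u = u , refl

-- Path partitions and path starts

module _ {A : Set} where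

  unique-⊆⇒length-≤ : ∀ {xs ys : List A} → Unique xs → (∀ {x} → x ∈ xs → x ∈ ys) →
                      length xs ≤ length ys
  unique-⊆⇒length-≤ {[]}     _            _    = z≤n
  unique-⊆⇒length-≤ {x ∷ xs} (x∉xs ∷ uxs) xs⊆ys with ∈-∃++ (xs⊆ys (here refl))
  ... | ys₁ , ys₂ , refl = begin
    suc (length xs)                 ≤⟨ s≤s (unique-⊆⇒length-≤ uxs xs⊆ys₁ys₂) ⟩
    suc (length (ys₁ ++ ys₂))       ≡⟨ cong suc (length-++ ys₁) ⟩
    suc (length ys₁ + length ys₂)   ≡⟨ +-suc (length ys₁) _ ⟨
    length ys₁ + length (x ∷ ys₂)   ≡⟨ length-++ ys₁ ⟨
    length (ys₁ ++ x ∷ ys₂)         ∎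
    where
    open ≤-Reasoning
    xs⊆ys₁ys₂ : ∀ {y} → y ∈ xs → y ∈ ys₁ ++ ys₂
    xs⊆ys₁ys₂ y∈xs with ∈-++⁻ ys₁ (xs⊆ys (there y∈xs))
    ... | inj₁ y∈ys₁         = ∈-++⁺ˡ y∈ys₁
    ... | inj₂ (here refl)   = ⊥-elim (All.lookup x∉xs y∈xs refl)
    ... | inj₂ (there y∈ys₂) = ∈-++⁺ʳ ys₁ y∈ys₂

  unique-++⇒disjoint : ∀ (xs : List A) {ys x} → Unique (xs ++ ys) → x ∈ xs → x ∈ ys → ⊥
  unique-++⇒disjoint (_ ∷ xs) u       (here refl)  x∈ys = Unique[x∷xs]⇒x∉xs u (∈-++⁺ʳ xs x∈ys)
  unique-++⇒disjoint (_ ∷ xs) (_ ∷ u) (there x∈xs) x∈ys = unique-++⇒disjoint xs u x∈xs x∈ys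

  unique-++⁻ʳ : ∀ (xs : List A) {ys} → Unique (xs ++ ys) → Unique ys
  unique-++⁻ʳ []       u       = u
  unique-++⁻ʳ (_ ∷ xs) (_ ∷ u) = unique-++⁻ʳ xs u

  length-filter-∷ : ∀ {P : A → Set} (P? : Decidable P) x xs →
                    length (filter P? (x ∷ xs)) ≡ ι (does (P? x)) + length (filter P? xs)
  length-filter-∷ P? x xs with does (P? x)
  ... | true  = refl
  ... | false = refl

  firstArc : List A → List (A × A)
  firstArc (x ∷ y ∷ _) = [ (x , y) ]
  firstArc _           = []

concatMap-unique⇒same : ∀ {A B : Set} (f : A → List B) {xs p q e} → Unique (concatMap f xs) →
                        p ∈ xs → q ∈ xs → e ∈ f p → e ∈ f q → p ≡ q
concatMap-unique⇒same f u (here refl) (here refl) _ _ = refl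
concatMap-unique⇒same f {p = p} u (here refl) (there q∈xs) e∈fp e∈fq =
  ⊥-elim (unique-++⇒disjoint (f p) u e∈fp (∈-concatMap⁺ f (lose q∈xs e∈fq)))
concatMap-unique⇒same f {q = q} u (there p∈xs) (here refl) e∈fp e∈fq =
  ⊥-elim (unique-++⇒disjoint (f q) u e∈fq (∈-concatMap⁺ f (lose p∈xs e∈fp)))
concatMap-unique⇒same f {x ∷ _} u (there p∈xs) (there q∈xs) e∈fp e∈fq =
  concatMap-unique⇒same f (unique-++⁻ʳ (f x) u) p∈xs q∈xs e∈fp e∈fq

module _ {n} (D : OrientedGraph n) where

  ∈-arcsOf-head : ∀ {a b} p → (a , b) ∈ arcsOf D p → a ∈ p
  ∈-arcsOf-head (x ∷ y ∷ r) (here refl) = here refl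
  ∈-arcsOf-head (x ∷ y ∷ r) (there ab)  = there (∈-arcsOf-head (y ∷ r) ab)

  ∈-arcsOf-tail : ∀ {a b x} r → (a , b) ∈ arcsOf D (x ∷ r) → b ∈ r
  ∈-arcsOf-tail (y ∷ r) (here refl) = here refl
  ∈-arcsOf-tail (y ∷ r) (there ab)  = there (∈-arcsOf-tail r ab)

  arcsOf-functional : ∀ {p a b c} → Unique p → (a , b) ∈ arcsOf D p → (a , c) ∈ arcsOf D p → b ≡ c
  arcsOf-functional {x ∷ y ∷ r} _ (here refl) (here refl) = refl
  arcsOf-functional {x ∷ y ∷ r} u (here refl) (there ac) =
    ⊥-elim (Unique[x∷xs]⇒x∉xs u (∈-arcsOf-head (y ∷ r) ac))
  arcsOf-functional {x ∷ y ∷ r} u (there ab) (here refl) =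
    ⊥-elim (Unique[x∷xs]⇒x∉xs u (∈-arcsOf-head (y ∷ r) ab))
  arcsOf-functional {x ∷ y ∷ r} (_ ∷ u) (there ab) (there ac) = arcsOf-functional u ab ac

  -- Every vertex of a directed triangle is the head of one of its arcs, so the
  -- first vertex of a path cannot lie on it.
  arcsOf-acyclic : ∀ {p a b c} → Unique p →
                   (a , b) ∈ arcsOf D p → (b , c) ∈ arcsOf D p → (c , a) ∈ arcsOf D p → ⊥
  arcsOf-acyclic {x ∷ y ∷ r} u (here refl) _ ca = Unique[x∷xs]⇒x∉xs u (∈-arcsOf-tail (y ∷ r) ca)
  arcsOf-acyclic {x ∷ y ∷ r} u ab (here refl) _ = Unique[x∷xs]⇒x∉xs u (∈-arcsOf-tail (y ∷ r) ab)
  arcsOf-acyclic {x ∷ y ∷ r} u _ bc (here refl) = Unique[x∷xs]⇒x∉xs u (∈-arcsOf-tail (y ∷ r) bc)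
  arcsOf-acyclic {x ∷ y ∷ r} (_ ∷ u) (there ab) (there bc) (there ca) = arcsOf-acyclic u ab bc ca

  arcsOf-first-or-preceded : ∀ {v w} p → (v , w) ∈ arcsOf D p →
                             (v , w) ∈ firstArc p ⊎ ∃ λ u → (u , v) ∈ arcsOf D p
  arcsOf-first-or-preceded (x ∷ y ∷ r)     (here refl) = inj₁ (here refl)
  arcsOf-first-or-preceded (x ∷ y ∷ z ∷ r) (there vw) with arcsOf-first-or-preceded (y ∷ z ∷ r) vw
  ... | inj₁ (here refl) = inj₂ (x , here refl)
  ... | inj₂ (u , uv)    = inj₂ (u , there uv)

firstArcs : ∀ {n} → List (List (Fin n)) → List (Fin n × Fin n)
firstArcs = concatMap firstArc

starts : ∀ {n} → List (List (Fin n)) → Fin n → ℕ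
starts P v = length (filter (λ e → proj₁ e ≟ v) (firstArcs P))

∑-starts≤length : ∀ {n} (P : List (List (Fin n))) → ∑ (starts P) ≤ length P
∑-starts≤length {n} P = ≤-trans (≤-reflexive (∑-filter (firstArcs P))) (length-firstArcs P)
  where
  tail≟ : (v : Fin n) → Decidable (λ (e : Fin n × Fin n) → proj₁ e ≡ v)
  tail≟ v e = proj₁ e ≟ v
  ∑-filter : ∀ (es : List (Fin n × Fin n)) → ∑ (λ v → length (filter (tail≟ v) es)) ≡ length es
  ∑-filter []       = trans (∑-const n 0) (*-zeroʳ n)
  ∑-filter (e ∷ es) = begin
    ∑ (λ v → length (filter (tail≟ v) (e ∷ es)))
      ≡⟨ sum-cong-≗ (λ v → length-filter-∷ (tail≟ v) e es) ⟩
    ∑ (λ v → ι (does (tail≟ v e)) + length (filter (tail≟ v) es))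
      ≡⟨ ∑-distrib-+ (λ v → ι (does (tail≟ v e))) _ ⟩
    ∑ (λ v → ι (does (proj₁ e ≟ v))) + ∑ (λ v → length (filter (tail≟ v) es))
      ≡⟨ cong₂ _+_ (∑-indicator-≡ (proj₁ e)) (∑-filter es) ⟩
    suc (length es)
      ∎
    where open ≡-Reasoning
  length-firstArcs : ∀ (P : List (List (Fin n))) → length (firstArcs P) ≤ length P
  length-firstArcs []                = z≤n
  length-firstArcs ([] ∷ P)          = m≤n⇒m≤1+n (length-firstArcs P)
  length-firstArcs ((_ ∷ []) ∷ P)    = m≤n⇒m≤1+n (length-firstArcs P)
  length-firstArcs ((_ ∷ _ ∷ _) ∷ P) = s≤s (length-firstArcs P)

length≤starts : ∀ {n} (P : List (List (Fin n))) {v W} → Unique W →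
                (∀ {w} → w ∈ W → (v , w) ∈ firstArcs P) → length W ≤ starts P v
length≤starts P {v} {W} uW first = begin
  length W              ≡⟨ length-map (v ,_) W ⟨
  length (map (v ,_) W) ≤⟨ unique-⊆⇒length-≤ (map⁺ (λ { refl → refl }) uW) ⊆-filter ⟩
  starts P v            ∎
  where
  open ≤-Reasoning
  ⊆-filter : ∀ {e} → e ∈ map (v ,_) W → e ∈ filter (λ e → proj₁ e ≟ v) (firstArcs P)
  ⊆-filter e∈ with ∈-map⁻ (v ,_) e∈
  ... | w , w∈W , refl = ∈-filter⁺ (λ e → proj₁ e ≟ v) (first w∈W) refl

module PathPartition {n} {D : OrientedGraph n} {P : List (List (Fin n))} (PP : IsPathPartition D P) where

  open IsPathPartition PP
  open IsDirectedPath

  record Continues (u v w : Fin n) : Set where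
    constructor continues
    field
      {path}  : List (Fin n)
      on-path : path ∈ P
      arc₁    : (u , v) ∈ arcsOf D path
      arc₂    : (v , w) ∈ arcsOf D path

  private
    path-unique : ∀ {p} → p ∈ P → Unique p
    path-unique p∈P = distinct (All.lookup paths p∈P)

    same-path : ∀ {p q e} → p ∈ P → q ∈ P → e ∈ arcsOf D p → e ∈ arcsOf D q → p ≡ q
    same-path = concatMap-unique⇒same (arcsOf D) disjoint

  continues-arc : ∀ {u v w} → Continues u v w → arc D u v ≡ true
  continues-arc (continues p∈P uv _) = All.lookup (followsArcs (All.lookup paths p∈P)) uv

  continues-functional : ∀ {u v w w′} → Continues u v w → Continues u v w′ → w ≡ w′
  continues-functional (continues p∈P uv vw) (continues q∈P uv′ vw′)
    with refl ← same-path p∈P q∈P uv uv′ = arcsOf-functional D (path-unique p∈P) vw vw′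

  continues-acyclic : ∀ {a b c} → Continues a b c → Continues b c a → ⊥
  continues-acyclic (continues p∈P ab bc) (continues q∈P bc′ ca)
    with refl ← same-path p∈P q∈P bc bc′ = arcsOf-acyclic D (path-unique p∈P) ab bc ca

  first-or-continues : ∀ {v w} → arc D v w ≡ true → (v , w) ∈ firstArcs P ⊎ ∃ λ u → Continues u v w
  first-or-continues a with find (∈-concatMap⁻ (arcsOf D) (covers _ _ a))
  ... | p , p∈P , vw with arcsOf-first-or-preceded D p vw
  ...   | inj₁ first    = inj₁ (∈-concatMap⁺ firstArc (lose p∈P first))
  ...   | inj₂ (u , uv) = inj₂ (u , continues p∈P uv vw)

  first-arc⇒0<starts : ∀ {v w} → (v , w) ∈ firstArcs P → 0 < starts P v
  first-arc⇒0<starts f = length≤starts P ([] ∷ []) λ { (here refl) → f }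

  first-arcs⇒1<starts : ∀ {v w w′} → w ≢ w′ → (v , w) ∈ firstArcs P → (v , w′) ∈ firstArcs P →
                        1 < starts P v
  first-arcs⇒1<starts w≢w′ f f′ =
    length≤starts P ((w≢w′ ∷ []) ∷ [] ∷ []) λ { (here refl) → f ; (there (here refl)) → f′ }

  source⇒0<starts : ∀ {v w} → arc D v w ≡ true → (∀ u → arc D u v ≡ false) → 0 < starts P v
  source⇒0<starts a no-in with first-or-continues a
  ... | inj₁ f       = first-arc⇒0<starts f
  ... | inj₂ (u , c) = contradictionᵇ (continues-arc c) (no-in u)

-- Gadgets

Exceeds : ℕ → ℕ → Set → Set
Exceeds b s T = b < s ⊎ (b ≤ s × T)

module _ {b₁ b₂ s₁ s₂ : ℕ} {T₁ T₂ : Set} where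

  infixl 6 _⊞_
  _⊞_ : Exceeds b₁ s₁ T₁ → Exceeds b₂ s₂ T₂ → Exceeds (b₁ + b₂) (s₁ + s₂) (T₁ × T₂)
  inj₁ b₁<s₁        ⊞ inj₁ b₂<s₂        = inj₁ (+-mono-<-≤ b₁<s₁ (<⇒≤ b₂<s₂))
  inj₁ b₁<s₁        ⊞ inj₂ (b₂≤s₂ , _)  = inj₁ (+-mono-<-≤ b₁<s₁ b₂≤s₂)
  inj₂ (b₁≤s₁ , _)  ⊞ inj₁ b₂<s₂        = inj₁ (+-mono-≤-< b₁≤s₁ b₂<s₂)
  inj₂ (b₁≤s₁ , t₁) ⊞ inj₂ (b₂≤s₂ , t₂) = inj₂ (+-mono-≤ b₁≤s₁ b₂≤s₂ , t₁ , t₂)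

exceeds-resolve : ∀ {b s T} → Exceeds b s T → ¬ T → b < s
exceeds-resolve (inj₁ b<s)     _  = b<s
exceeds-resolve (inj₂ (_ , t)) ¬t = ⊥-elim (¬t t)

bool-pigeonhole : ∀ (x y z : Bool) → x ≡ y ⊎ x ≡ z ⊎ y ≡ z
bool-pigeonhole false false _     = inj₁ refl
bool-pigeonhole true  true  _     = inj₁ refl
bool-pigeonhole false true  false = inj₂ (inj₁ refl)
bool-pigeonhole false true  true  = inj₂ (inj₂ refl)
bool-pigeonhole true  false false = inj₂ (inj₂ refl)
bool-pigeonhole true  false true  = inj₂ (inj₁ refl)

-- Otherwise π would be constant (equal to not i), and so would π ∘ σ.
fixed-point-free-∘ : ∀ (σ π : Bool → Bool) → (∀ i → π (σ i) ≢ i) → ∀ i j → σ i ≡ j ⊎ π j ≡ i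
fixed-point-free-∘ σ π fpf i j with σ i ≟ᵇ j | π j ≟ᵇ i
... | yes σi≡j | _        = inj₁ σi≡j
... | no _     | yes πj≡i = inj₂ πj≡i
... | no σi≢j  | no πj≢i  = ⊥-elim (fpf (not i) (π-constant (σ (not i))))
  where
  π-constant : ∀ b → π b ≡ not i
  π-constant b with b ≟ᵇ j
  ... | yes refl = ¬-not πj≢i
  ... | no b≢j   = trans (cong π (trans (¬-not b≢j) (sym (¬-not σi≢j)))) (¬-not (fpf i))

record Gadget {n} (D : OrientedGraph n) : Set where
  field
    hub          : Fin n
    mid rim      : Bool → Fin n
    mid-distinct : mid false ≢ mid true
    rim-distinct : rim false ≢ rim true
    hub→mid      : ∀ i → arc D hub (mid i) ≡ true
    mid→rim      : ∀ i j → arc D (mid i) (rim j) ≡ true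
    rim→hub      : ∀ j → arc D (rim j) hub ≡ true
    into-mid     : ∀ i x → arc D x (mid i) ≡ true → x ≡ hub
    into-rim     : ∀ j x → arc D x (rim j) ≡ true → ∃ λ i → x ≡ mid i

record ExitGadget {n} (D : OrientedGraph n) : Set where
  field
    gadget : Gadget D
  open Gadget gadget
  field
    exit     : Fin n
    exit≢mid : ∀ i → exit ≢ mid i
    hub→exit : arc D hub exit ≡ true
    into-hub : ∀ x → arc D x hub ≡ true → ∃ λ j → x ≡ rim j

record EntryGadget {n} (D : OrientedGraph n) : Set where
  field
    gadget : Gadget D
  open Gadget gadget
  field
    entry    : Fin n
    into-hub : ∀ x → arc D x hub ≡ true → (∃ λ j → x ≡ rim j) ⊎ x ≡ entry

gadgetStarts : ∀ {n} {D : OrientedGraph n} → List (List (Fin n)) → Gadget D → ℕ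
gadgetStarts P g = (starts P (mid false) + starts P (mid true))
                 + (starts P (rim false) + starts P (rim true))
                 + starts P hub
  where open Gadget g

module _ {n} {D : OrientedGraph n} {P} (PP : IsPathPartition D P) where

  open PathPartition PP

  module _ (g : Gadget D) where

    open Gadget g

    private
      from-hub : ∀ {i w} → ∃ (λ u → Continues u (mid i) w) → Continues hub (mid i) w
      from-hub {i} (u , c) = subst (λ x → Continues x (mid i) _) (into-mid i u (continues-arc c)) c

      mid-exceeds : ∀ i → Exceeds 1 (starts P (mid i)) (∃ λ j → Continues hub (mid i) (rim j))
      mid-exceeds i with first-or-continues (mid→rim i false) | first-or-continues (mid→rim i true)
      ... | inj₁ f₀ | inj₁ f₁ = inj₁ (first-arcs⇒1<starts rim-distinct f₀ f₁)
      ... | inj₁ f₀ | inj₂ c₁ = inj₂ (first-arc⇒0<starts f₀ , true , from-hub c₁)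
      ... | inj₂ c₀ | inj₁ f₁ = inj₂ (first-arc⇒0<starts f₁ , false , from-hub c₀)
      ... | inj₂ c₀ | inj₂ c₁ = ⊥-elim (rim-distinct (continues-functional (from-hub c₀) (from-hub c₁)))

      rim-exceeds : ∀ j → Exceeds 0 (starts P (rim j)) (∃ λ i → Continues (mid i) (rim j) hub)
      rim-exceeds j with first-or-continues (rim→hub j)
      ... | inj₁ f       = inj₁ (first-arc⇒0<starts f)
      ... | inj₂ (u , c) with into-rim j u (continues-arc c)
      ...   | i , refl   = inj₂ (z≤n , i , c)

      -- No path runs around a triangle, so π ∘ σ has no fixed point, and then the
      -- path through rim j → hub → mid i closes a triangle.
      not-tight : (∃₂ λ i j → Continues (rim j) hub (mid i)) →
                  (∀ i → ∃ λ j → Continues hub (mid i) (rim j)) →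
                  (∀ j → ∃ λ i → Continues (mid i) (rim j) hub) → ⊥
      not-tight (i , j , entered) next prev with fixed-point-free-∘ σ π no-triangle i j
        where
        σ π : Bool → Bool
        σ = proj₁ ∘ next
        π = proj₁ ∘ prev
        no-triangle : ∀ i → π (σ i) ≢ i
        no-triangle i e = continues-acyclic (proj₂ (next i))
          (subst (λ i′ → Continues (mid i′) (rim (σ i)) hub) e (proj₂ (prev (σ i))))
      ... | inj₁ σi≡j = continues-acyclic entered
          (subst (λ j′ → Continues hub (mid i) (rim j′)) σi≡j (proj₂ (next i)))
      ... | inj₂ πj≡i = continues-acyclic
          (subst (λ i′ → Continues (mid i′) (rim j) hub) πj≡i (proj₂ (prev j))) entered

    2+b<gadgetStarts : ∀ {b} → Exceeds b (starts P hub) (∃₂ λ i j → Continues (rim j) hub (mid i)) →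
                     2 + b < gadgetStarts P g
    2+b<gadgetStarts hub-exceeds = exceeds-resolve
      ((mid-exceeds false ⊞ mid-exceeds true) ⊞ (rim-exceeds false ⊞ rim-exceeds true) ⊞ hub-exceeds)
      λ { (((next₀ , next₁) , (prev₀ , prev₁)) , entered) →
            not-tight entered (λ { false → next₀ ; true → next₁ }) (λ { false → prev₀ ; true → prev₁ }) }

  gadgetStarts-exit : (x : ExitGadget D) → 3 < gadgetStarts P (ExitGadget.gadget x)
  gadgetStarts-exit x = 2+b<gadgetStarts gadget hub-exceeds
    where
    open ExitGadget x
    open Gadget gadget

    from-rim : ∀ {w} → ∃ (λ u → Continues u hub w) → ∃ λ j → Continues (rim j) hub w
    from-rim (u , c) with into-hub u (continues-arc c)
    ... | j , refl = j , c

    three-continued : ∃ (λ j → Continues (rim j) hub (mid false)) →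
                      ∃ (λ j → Continues (rim j) hub (mid true)) →
                      ∃ (λ j → Continues (rim j) hub exit) → ⊥
    three-continued (j₀ , c₀) (j₁ , c₁) (jₑ , cₑ) with bool-pigeonhole j₀ j₁ jₑ
    ... | inj₁ refl        = mid-distinct (continues-functional c₀ c₁)
    ... | inj₂ (inj₁ refl) = exit≢mid false (continues-functional cₑ c₀)
    ... | inj₂ (inj₂ refl) = exit≢mid true (continues-functional cₑ c₁)

    hub-exceeds : Exceeds 1 (starts P hub) (∃₂ λ i j → Continues (rim j) hub (mid i))
    hub-exceeds with first-or-continues (hub→mid false) | first-or-continues (hub→mid true)
                   | first-or-continues hub→exit
    ... | inj₁ f₀ | inj₁ f₁ | _       = inj₁ (first-arcs⇒1<starts mid-distinct f₀ f₁)
    ... | inj₁ f₀ | inj₂ _  | inj₁ fₑ = inj₁ (first-arcs⇒1<starts (exit≢mid false ∘ sym) f₀ fₑ)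
    ... | inj₂ _  | inj₁ f₁ | inj₁ fₑ = inj₁ (first-arcs⇒1<starts (exit≢mid true ∘ sym) f₁ fₑ)
    ... | inj₁ f₀ | inj₂ c₁ | inj₂ _  = inj₂ (first-arc⇒0<starts f₀ , true , from-rim c₁)
    ... | inj₂ c₀ | inj₁ f₁ | inj₂ _  = inj₂ (first-arc⇒0<starts f₁ , false , from-rim c₀)
    ... | inj₂ c₀ | inj₂ _  | inj₁ fₑ = inj₂ (first-arc⇒0<starts fₑ , false , from-rim c₀)
    ... | inj₂ c₀ | inj₂ c₁ | inj₂ cₑ = ⊥-elim (three-continued (from-rim c₀) (from-rim c₁) (from-rim cₑ))

  gadgetStarts-entry : (y : EntryGadget D) → 2 < gadgetStarts P (EntryGadget.gadget y)
  gadgetStarts-entry y = 2+b<gadgetStarts gadget hub-exceeds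
    where
    open EntryGadget y
    open Gadget gadget

    hub-exceeds : Exceeds 0 (starts P hub) (∃₂ λ i j → Continues (rim j) hub (mid i))
    hub-exceeds with first-or-continues (hub→mid false) | first-or-continues (hub→mid true)
    ... | inj₁ f₀ | _       = inj₁ (first-arc⇒0<starts f₀)
    ... | inj₂ _  | inj₁ f₁ = inj₁ (first-arc⇒0<starts f₁)
    ... | inj₂ (u₀ , c₀) | inj₂ (u₁ , c₁)
        with into-hub u₀ (continues-arc c₀) | into-hub u₁ (continues-arc c₁)
    ...   | inj₁ (j , refl) | _               = inj₂ (z≤n , false , j , c₀)
    ...   | inj₂ _          | inj₁ (j , refl) = inj₂ (z≤n , true , j , c₁)
    ...   | inj₂ refl       | inj₂ refl       = ⊥-elim (mid-distinct (continues-functional c₀ c₁))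

module _ {m n} {E : OrientedGraph m} {G : OrientedGraph n} (φ : InClosedEmbedding E G) where

  private
    arc-embed : ∀ {u v} → arc E u v ≡ true → arc G (embed φ u) (embed φ v) ≡ true
    arc-embed = trans (preserves-arc φ _ _)

    embed-≡ : ∀ {x u u′} → x ≡ embed φ u → u ≡ u′ → x ≡ embed φ u′
    embed-≡ x≡ u≡ = trans x≡ (cong (embed φ) u≡)

  gadget-embed : Gadget E → Gadget G
  gadget-embed g = record
    { hub          = embed φ hub
    ; mid          = embed φ ∘ mid
    ; rim          = embed φ ∘ rim
    ; mid-distinct = mid-distinct ∘ injective φ
    ; rim-distinct = rim-distinct ∘ injective φ
    ; hub→mid      = arc-embed ∘ hub→mid
    ; mid→rim      = λ i → arc-embed ∘ mid→rim i
    ; rim→hub      = arc-embed ∘ rim→hub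
    ; into-mid     = λ i x a → let u , x≡ , a′ = reflect-in φ a in embed-≡ x≡ (into-mid i u a′)
    ; into-rim     = λ j x a → let u , x≡ , a′ = reflect-in φ a ; i , u≡ = into-rim j u a′ in
                               i , embed-≡ x≡ u≡
    }
    where open Gadget g

  exit-embed : ExitGadget E → ExitGadget G
  exit-embed x = record
    { gadget   = gadget-embed gadget
    ; exit     = embed φ exit
    ; exit≢mid = λ i → exit≢mid i ∘ injective φ
    ; hub→exit = arc-embed hub→exit
    ; into-hub = λ x a → let u , x≡ , a′ = reflect-in φ a ; j , u≡ = into-hub u a′ in
                         j , embed-≡ x≡ u≡
    }
    where
    open ExitGadget x
    open Gadget gadget

  entry-embed : EntryGadget E → EntryGadget G
  entry-embed y = record
    { gadget   = gadget-embed gadget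
    ; entry    = embed φ entry
    ; into-hub = λ x a → let u , x≡ , a′ = reflect-in φ a in
                         Sum.map (λ { (j , u≡) → j , embed-≡ x≡ u≡ }) (embed-≡ x≡) (into-hub u a′)
    }
    where
    open EntryGadget y
    open Gadget gadget

-- Surplus and degrees

imbalance : ∀ {n} → OrientedGraph n → ℕ
imbalance D = ∑ λ v → ∣ outdeg D v - indeg D v ∣

imbalance-⊕ : ∀ {m n} (D : OrientedGraph m) (E : OrientedGraph n) →
              imbalance (D ⊕ E) ≡ imbalance D + imbalance E
imbalance-⊕ {m} D E = trans (∑-↑ m _) (cong₂ _+_ (sum-cong-≗ left-part) (sum-cong-≗ right-part))
  where
  left-part : ∀ v → ∣ outdeg (D ⊕ E) (v ↑ˡ _) - indeg (D ⊕ E) (v ↑ˡ _) ∣ ≡ ∣ outdeg D v - indeg D v ∣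
  left-part v = cong₂ ∣_-_∣ (degree-↑ˡ D E refl outdeg-by v) (degree-↑ˡ D E refl indeg-by v)
  right-part : ∀ v → ∣ outdeg (D ⊕ E) (m ↑ʳ v) - indeg (D ⊕ E) (m ↑ʳ v) ∣ ≡ ∣ outdeg E v - indeg E v ∣
  right-part v = cong₂ ∣_-_∣ (degree-↑ʳ D E refl outdeg-by v) (degree-↑ʳ D E refl indeg-by v)

HasSurplus : ∀ {m} → ℕ → OrientedGraph m → Set
HasSurplus c E = ∀ {n} {G : OrientedGraph n} {P} → IsPathPartition G P →
                 (φ : InClosedEmbedding E G) → imbalance E + c ≤ 2 * ∑ (starts P ∘ embed φ)

surplus-mono : ∀ {m c c′} {E : OrientedGraph m} → c′ ≤ c → HasSurplus c E → HasSurplus c′ E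
surplus-mono c′≤c h PP φ = ≤-trans (+-monoʳ-≤ _ c′≤c) (h PP φ)

surplus-empty : HasSurplus 0 empty
surplus-empty PP φ = z≤n

surplus-⊕ : ∀ {m n c c′} {D : OrientedGraph m} {E : OrientedGraph n} →
            HasSurplus c D → HasSurplus c′ E → HasSurplus (c + c′) (D ⊕ E)
surplus-⊕ {m} {n} {c} {c′} {D} {E} hD hE {P = P} PP φ = begin
  imbalance (D ⊕ E) + (c + c′)
    ≡⟨ cong (_+ (c + c′)) (imbalance-⊕ D E) ⟩
  imbalance D + imbalance E + (c + c′)
    ≡⟨ interchange (imbalance D) (imbalance E) c c′ ⟩
  (imbalance D + c) + (imbalance E + c′)
    ≤⟨ +-mono-≤ (hD PP (φ ∘ᵉ ↑ˡ-embedding)) (hE PP (φ ∘ᵉ ↑ʳ-embedding)) ⟩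
  2 * ∑ (s ∘ (_↑ˡ n)) + 2 * ∑ (s ∘ (m ↑ʳ_))
    ≡⟨ *-distribˡ-+ 2 (∑ (s ∘ (_↑ˡ n))) (∑ (s ∘ (m ↑ʳ_))) ⟨
  2 * (∑ (s ∘ (_↑ˡ n)) + ∑ (s ∘ (m ↑ʳ_)))
    ≡⟨ cong (2 *_) (∑-↑ m s) ⟨
  2 * ∑ s
    ∎
  where
  open ≤-Reasoning
  s = starts P ∘ embed φ

surplus-copies : ∀ {m c} {E : OrientedGraph m} → HasSurplus c E → ∀ k → HasSurplus (k * c) (copies k E)
surplus-copies h zero    = surplus-empty
surplus-copies h (suc k) = surplus-⊕ h (surplus-copies h k)

half-≤ : ∀ x c z → x + 2 * c ≤ 2 * z → x / 2 + c ≤ z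
half-≤ x c z x+2c≤2z = begin
  x / 2 + c              ≡⟨ cong (x / 2 +_) (m*n/n≡m c 2) ⟨
  x / 2 + c * 2 / 2      ≡⟨ +-distrib-/-∣ʳ x (divides-refl c) ⟨
  (x + c * 2) / 2        ≤⟨ /-monoˡ-≤ 2 (subst₂ _≤_ (cong (x +_) (*-comm 2 c)) (*-comm 2 z) x+2c≤2z) ⟩
  z * 2 / 2              ≡⟨ m*n/n≡m z 2 ⟩
  z                      ∎
  where open ≤-Reasoning

surplus⇒pn : ∀ {n} {G : OrientedGraph n} {c} → HasSurplus (2 * c) G → PnAtLeast G (ex G + c)
surplus⇒pn {G = G} {c} surplus P PP = begin
  ex G + c             ≡⟨ cong (λ x → x / 2 + c) (sum-map-allFin (λ v → ∣ outdeg G v - indeg G v ∣)) ⟩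
  imbalance G / 2 + c  ≤⟨ half-≤ (imbalance G) c (length P)
                            (≤-trans (surplus PP id-embedding) (*-monoʳ-≤ 2 (∑-starts≤length P))) ⟩
  length P             ∎
  where open ≤-Reasoning

pn-gap⇒¬consistent : ∀ {n} {G : OrientedGraph n} {c} → 0 < c → PnAtLeast G (ex G + c) → ¬ Consistent G
pn-gap⇒¬consistent {G = G} (s≤s z≤n) pn ((P , PP , |P|≡ex) , _) =
  m+1+n≰m (ex G) (subst (ex G + _ ≤_) |P|≡ex (pn P PP))

AllDegrees : ∀ {n} → (ℕ → Set) → OrientedGraph n → Set
AllDegrees Q D = ∀ v → Q (udeg D v)

module _ (Q : ℕ → Set) where

  all-degrees-⊕ : ∀ {m n} {D : OrientedGraph m} {E : OrientedGraph n} →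
                  AllDegrees Q D → AllDegrees Q E → AllDegrees Q (D ⊕ E)
  all-degrees-⊕ {m} {D = D} {E} qD qE v with splitView m v
  ... | left u  = subst Q (sym (degree-↑ˡ D E refl udeg-by u)) (qD u)
  ... | right u = subst Q (sym (degree-↑ʳ D E refl udeg-by u)) (qE u)

  all-degrees-copies : ∀ {m} {E : OrientedGraph m} → AllDegrees Q E → ∀ k → AllDegrees Q (copies k E)
  all-degrees-copies q zero    = λ ()
  all-degrees-copies q (suc k) = all-degrees-⊕ q (all-degrees-copies q k)

maxUDeg-attained : ∀ {n} {D : OrientedGraph n} {d} → AllDegrees (_≤ d) D → ∀ v → udeg D v ≡ d →
                   maxUDeg D ≡ d
maxUDeg-attained {n} {D} {d} bounded v udeg≡d =
  ≤-antisym (lub (allFin n)) (subst (_≤ maxUDeg D) udeg≡d (member (allFin n) (∈-allFin v)))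
  where
  lub : ∀ xs → foldr _⊔_ 0 (map (udeg D) xs) ≤ d
  lub []       = z≤n
  lub (x ∷ xs) = ⊔-lub (bounded x) (lub xs)
  member : ∀ xs {v} → v ∈ xs → udeg D v ≤ foldr _⊔_ 0 (map (udeg D) xs)
  member (x ∷ xs) (here refl) = m≤m⊔n _ _
  member (x ∷ xs) (there v∈) = ≤-trans (member xs v∈) (m≤n⊔m _ _)

-- Stars and blocks

star : ∀ s → OrientedGraph (suc s)
star s = record { arc = leaf→centre ; irrefl = irr ; antisym = asym }
  where
  leaf→centre : Fin (suc s) → Fin (suc s) → Bool
  leaf→centre (suc _) zero = true
  leaf→centre _       _    = false
  irr : ∀ v → leaf→centre v v ≡ false
  irr zero    = refl
  irr (suc _) = refl
  asym : ∀ u v → leaf→centre u v ≡ true → leaf→centre v u ≡ false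
  asym (suc _) zero    _ = refl
  asym zero    _       ()
  asym (suc _) (suc _) ()

module _ {F : Bool → Bool → Bool} {deg : Degree} (deg-by : IsDegreeBy F deg) {s : ℕ} where

  degree-centre : deg (star s) zero ≡ ι (F false false) + s * ι (F false true)
  degree-centre = trans (degree≡degreeBy deg-by _ _) (cong (ι (F false false) +_) (∑-const s _))

  degree-leaf : ∀ t → deg (star s) (suc t) ≡ ι (F true false) + s * ι (F false false)
  degree-leaf t = trans (degree≡degreeBy deg-by _ _) (cong (ι (F true false) +_) (∑-const s _))

module _ {s : ℕ} where

  udeg-centre : udeg (star s) zero ≡ s
  udeg-centre = trans (degree-centre udeg-by {s}) (*-identityʳ s)

  udeg-leaf : ∀ t → udeg (star s) (suc t) ≡ 1
  udeg-leaf t = trans (degree-leaf udeg-by {s} t) (cong suc (*-zeroʳ s))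

  imbalance-star : imbalance (star s) ≡ 2 * s
  imbalance-star = begin
    imbalance (star s)     ≡⟨ cong₂ _+_ centre (sum-cong-≗ leaf) ⟩
    s + ∑ {s} (λ _ → 1)    ≡⟨ cong (s +_) (trans (∑-const s 1) (*-identityʳ s)) ⟩
    s + s                  ≡⟨ cong (s +_) (+-identityʳ s) ⟨
    2 * s                  ∎
    where
    open ≡-Reasoning
    centre : ∣ outdeg (star s) zero - indeg (star s) zero ∣ ≡ s
    centre = cong₂ ∣_-_∣ (trans (degree-centre outdeg-by {s}) (*-zeroʳ s))
                         (trans (degree-centre indeg-by {s}) (*-identityʳ s))
    leaf : ∀ t → ∣ outdeg (star s) (suc t) - indeg (star s) (suc t) ∣ ≡ 1
    leaf t = cong₂ ∣_-_∣ (trans (degree-leaf outdeg-by {s} t) (cong suc (*-zeroʳ s)))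
                         (trans (degree-leaf indeg-by {s} t) (*-zeroʳ s))

all-degrees-star : ∀ (Q : ℕ → Set) {s} → Q s → Q 1 → AllDegrees Q (star s)
all-degrees-star Q qs q1 zero    = subst Q (sym udeg-centre) qs
all-degrees-star Q qs q1 (suc t) = subst Q (sym (udeg-leaf t)) q1

surplus-star : ∀ s → HasSurplus 0 (star s)
surplus-star s {P = P} PP φ = begin
  imbalance (star s) + 0        ≡⟨ trans (+-identityʳ _) (imbalance-star {s}) ⟩
  2 * s                         ≤⟨ *-monoʳ-≤ 2 leaves ⟩
  2 * ∑ (starts P ∘ embed φ)    ∎
  where
  open ≤-Reasoning
  open PathPartition PP
  leaf-starts : ∀ t → 0 < starts P (embed φ (suc t))
  leaf-starts t = source⇒0<starts (trans (preserves-arc φ (suc t) zero) refl)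
                                  (no-in-embed φ λ { zero → refl ; (suc _) → refl })
  leaves : s ≤ ∑ (starts P ∘ embed φ)
  leaves = begin
    s                                    ≡⟨ trans (∑-const s 1) (*-identityʳ s) ⟨
    ∑ {s} (λ _ → 1)                      ≤⟨ ∑-mono-≤ leaf-starts ⟩
    ∑ (λ t → starts P (embed φ (suc t))) ≤⟨ m≤n+m _ _ ⟩
    ∑ (starts P ∘ embed φ)               ∎

-- Two copies of the gadget h → a₁, a₂ → b₁, b₂ → h, on 0–4 and on 5–9,
-- joined by the arc 0 → 5.
blockArc : Fin 10 → Fin 10 → Bool
blockArc 0F 1F = true
blockArc 0F 2F = true
blockArc 1F 3F = true
blockArc 1F 4F = true
blockArc 2F 3F = true
blockArc 2F 4F = true
blockArc 3F 0F = true
blockArc 4F 0F = true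
blockArc 0F 5F = true
blockArc 5F 6F = true
blockArc 5F 7F = true
blockArc 6F 8F = true
blockArc 6F 9F = true
blockArc 7F 8F = true
blockArc 7F 9F = true
blockArc 8F 5F = true
blockArc 9F 5F = true
blockArc _  _  = false

block : OrientedGraph 10
block = record
  { arc     = blockArc
  ; irrefl  = from-yes (all? λ v → blockArc v v ≟ᵇ false)
  ; antisym = from-yes (all? λ u → all? λ v → (blockArc u v ≟ᵇ true) →-dec (blockArc v u ≟ᵇ false))
  }

private
  pick : ∀ {A : Set} → A → A → Bool → A
  pick x y false = x
  pick x y true  = y

  one-of? : ∀ (a₁ a₂ x : Fin 10) → Dec (∃ λ i → x ≡ pick a₁ a₂ i)
  one-of? a₁ a₂ x = map′ [ (false ,_) , (true ,_) ]′ (λ { (false , e) → inj₁ e ; (true , e) → inj₂ e })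
                         (x ≟ a₁ ⊎-dec x ≟ a₂)

  in-neighbours? : ∀ v {Q : Fin 10 → Set} → Decidable Q → Dec (∀ x → blockArc x v ≡ true → Q x)
  in-neighbours? v Q? = all? λ x → (blockArc x v ≟ᵇ true) →-dec Q? x

block-exit : ExitGadget block
block-exit = record
  { gadget = record
    { hub          = 0F
    ; mid          = pick 1F 2F
    ; rim          = pick 3F 4F
    ; mid-distinct = λ ()
    ; rim-distinct = λ ()
    ; hub→mid      = λ { false → refl ; true → refl }
    ; mid→rim      = λ { false false → refl ; false true → refl ; true false → refl ; true true → refl }
    ; rim→hub      = λ { false → refl ; true → refl }
    ; into-mid     = λ { false → from-yes (in-neighbours? 1F (_≟ 0F))
                       ; true  → from-yes (in-neighbours? 2F (_≟ 0F)) }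
    ; into-rim     = λ { false → from-yes (in-neighbours? 3F (one-of? 1F 2F))
                       ; true  → from-yes (in-neighbours? 4F (one-of? 1F 2F)) }
    }
  ; exit     = 5F
  ; exit≢mid = λ { false () ; true () }
  ; hub→exit = refl
  ; into-hub = from-yes (in-neighbours? 0F (one-of? 3F 4F))
  }

block-entry : EntryGadget block
block-entry = record
  { gadget = record
    { hub          = 5F
    ; mid          = pick 6F 7F
    ; rim          = pick 8F 9F
    ; mid-distinct = λ ()
    ; rim-distinct = λ ()
    ; hub→mid      = λ { false → refl ; true → refl }
    ; mid→rim      = λ { false false → refl ; false true → refl ; true false → refl ; true true → refl }
    ; rim→hub      = λ { false → refl ; true → refl }
    ; into-mid     = λ { false → from-yes (in-neighbours? 6F (_≟ 5F))
                       ; true  → from-yes (in-neighbours? 7F (_≟ 5F)) }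
    ; into-rim     = λ { false → from-yes (in-neighbours? 8F (one-of? 6F 7F))
                       ; true  → from-yes (in-neighbours? 9F (one-of? 6F 7F)) }
    }
  ; entry    = 0F
  ; into-hub = from-yes (in-neighbours? 5F λ x → one-of? 8F 9F x ⊎-dec x ≟ 0F)
  }

surplus-block : HasSurplus 4 block
surplus-block {P = P} PP φ = begin
  14               ≤⟨ *-monoʳ-≤ 2 (+-mono-≤ exit-starts entry-starts) ⟩
  2 * (X + Y)      ≡⟨ cong (2 *_) (regroup (s 0F) (s 1F) (s 2F) (s 3F) (s 4F)
                                           (s 5F) (s 6F) (s 7F) (s 8F) (s 9F)) ⟩
  2 * ∑ s          ∎
  where
  open ≤-Reasoning
  s = starts P ∘ embed φ
  X = gadgetStarts P (ExitGadget.gadget (exit-embed φ block-exit))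
  Y = gadgetStarts P (EntryGadget.gadget (entry-embed φ block-entry))
  exit-starts : 4 ≤ X
  exit-starts = gadgetStarts-exit PP (exit-embed φ block-exit)
  entry-starts : 3 ≤ Y
  entry-starts = gadgetStarts-entry PP (entry-embed φ block-entry)
  regroup : ∀ s₀ s₁ s₂ s₃ s₄ s₅ s₆ s₇ s₈ s₉ →
            s₁ + s₂ + (s₃ + s₄) + s₀ + (s₆ + s₇ + (s₈ + s₉) + s₅)
            ≡ s₀ + (s₁ + (s₂ + (s₃ + (s₄ + (s₅ + (s₆ + (s₇ + (s₈ + (s₉ + 0)))))))))
  regroup = solve-∀

-- The graphs Gₖ

extraSize : ℕ → ℕ
extraSize zero    = 0
extraSize (suc j) = suc (2 * suc j + 5) + (4 * j + 1) * 2

-- star 1 is a single arc: for k = suc j this is a star with 2k + 5 leaves and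
-- 4k − 3 disjoint arcs.
extra : ∀ k → OrientedGraph (extraSize k)
extra zero    = empty
extra (suc j) = star (2 * suc j + 5) ⊕ copies (4 * j + 1) (star 1)

G[_] : ∀ k → OrientedGraph (suc k * 10 + extraSize k)
G[ k ] = copies (suc k) block ⊕ extra k

vertex-count : ∀ k → suc k * 10 + extraSize k ≡ 20 * k + 10
vertex-count zero    = refl
vertex-count (suc j) = count j
  where
  count : ∀ j → (10 + suc j * 10) + (suc (2 * suc j + 5) + (4 * j + 1) * 2) ≡ 20 * suc j + 10
  count = solve-∀

Odd : ℕ → Set
Odd d = d % 2 ≡ 1

G-odd : ∀ k → AllDegrees Odd G[ k ]
G-odd k = all-degrees-⊕ Odd (all-degrees-copies Odd block-odd (suc k)) (extra-odd k)
  where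
  block-odd : AllDegrees Odd block
  block-odd = from-yes (all? λ v → udeg block v % 2 ≟ℕ 1)
  2k+5-odd : ∀ k → Odd (2 * k + 5)
  2k+5-odd k = trans (cong (_% 2) (shape k)) ([m+kn]%n≡m%n 1 (k + 2) 2)
    where
    shape : ∀ k → 2 * k + 5 ≡ 1 + (k + 2) * 2
    shape = solve-∀
  extra-odd : ∀ k → AllDegrees Odd (extra k)
  extra-odd zero    = λ ()
  extra-odd (suc j) =
    all-degrees-⊕ Odd (all-degrees-star Odd (2k+5-odd (suc j)) refl)
                      (all-degrees-copies Odd (all-degrees-star Odd {1} refl refl) (4 * j + 1))

G-bounded : ∀ k → AllDegrees (_≤ 2 * k + 5) G[ k ]
G-bounded k = all-degrees-⊕ (_≤ 2 * k + 5) (all-degrees-copies (_≤ 2 * k + 5) block-bounded (suc k))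
                                           (extra-bounded k)
  where
  block-bounded : AllDegrees (_≤ 2 * k + 5) block
  block-bounded v = ≤-trans (from-yes (all? λ v → udeg block v ≤? 5) v) (m≤n+m 5 (2 * k))
  1≤2k+5 : ∀ k → 1 ≤ 2 * k + 5
  1≤2k+5 k = ≤-trans (s≤s z≤n) (m≤n+m 5 (2 * k))
  extra-bounded : ∀ k → AllDegrees (_≤ 2 * k + 5) (extra k)
  extra-bounded zero      = λ ()
  extra-bounded k@(suc j) =
    all-degrees-⊕ Q (all-degrees-star Q ≤-refl (1≤2k+5 k))
                    (all-degrees-copies Q (all-degrees-star Q {1} (1≤2k+5 k) (1≤2k+5 k)) (4 * j + 1))
    where
    Q = _≤ 2 * k + 5

G-peak : ∀ k → ∃ λ v → udeg G[ k ] v ≡ 2 * k + 5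
G-peak zero    = (0F ↑ˡ 0) ↑ˡ 0 ,
  trans (degree-↑ˡ (copies 1 block) (extra 0) refl udeg-by (0F ↑ˡ 0))
        (degree-↑ˡ block empty refl udeg-by 0F)
G-peak (suc j) = (suc (suc j) * 10) ↑ʳ (0F ↑ˡ (4 * j + 1) * 2) ,
  trans (degree-↑ʳ (copies (2 + j) block) (extra (suc j)) refl udeg-by (0F ↑ˡ (4 * j + 1) * 2))
        (trans (degree-↑ˡ (star (2 * suc j + 5)) (copies (4 * j + 1) (star 1)) refl udeg-by 0F)
               (udeg-centre {2 * suc j + 5}))

G-surplus : ∀ k → HasSurplus (2 * (2 * k + 2)) G[ k ]
G-surplus k = surplus-mono (≤-reflexive (shape k))
                           (surplus-⊕ (surplus-copies surplus-block (suc k)) (extra-surplus k))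
  where
  shape : ∀ k → 2 * (2 * k + 2) ≡ suc k * 4 + 0
  shape = solve-∀
  extra-surplus : ∀ k → HasSurplus 0 (extra k)
  extra-surplus zero    = surplus-empty
  extra-surplus (suc j) =
    surplus-⊕ (surplus-star _) (surplus-mono z≤n (surplus-copies (surplus-star 1) (4 * j + 1)))

Proposition5p1Graph : ℕ → ∀ {n} → OrientedGraph n → Set
Proposition5p1Graph k G = (maxUDeg G ≡ 2 * k + 5)
                        × ((∀ v → udeg G v % 2 ≡ 1)
                        × (PnAtLeast G (ex G + (2 * k + 2))
                        × (¬ Consistent G)))

proposition5p1 : (k : ℕ) → Σ (OrientedGraph (20 * k + 10)) (λ G →
    (maxUDeg G ≡ 2 * k + 5)
    × ((∀ v → udeg G v % 2 ≡ 1)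
    × (PnAtLeast G (ex G + (2 * k + 2))
    × (¬ Consistent G))))
proposition5p1 k = subst (λ n → Σ (OrientedGraph n) (Proposition5p1Graph k)) (vertex-count k)
  (G[ k ] , maxUDeg-attained {D = G[ k ]} (G-bounded k) peak udeg-peak , G-odd k , pn ,
   pn-gap⇒¬consistent 0<2k+2 pn)
  where
  peak = proj₁ (G-peak k)
  udeg-peak = proj₂ (G-peak k)
  pn = surplus⇒pn (G-surplus k)
  0<2k+2 : 0 < 2 * k + 2
  0<2k+2 = ≤-trans (s≤s z≤n) (m≤n+m 2 (2 * k))
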